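{- For every integer $t\geq 4$ there exists a $(3,4t;4)$-CHDM.
   Context: Let $Z_v$ denote the integers modulo $v$. A $(k,wt;w)$-CHDM is a $k\times w(t-1)$ matrix $D=(d_{ij})$ with entries in $Z_{wt}$ such that for any two distinct rows $x,y$ the list $\{d_{xj}-d_{yj}: 0\le j\le w(t-1)-1\}$ contains each element of $Z_{wt}\setminus\{0,t,\ldots,(w-1)t\}$ exactly once. -}

module Defs where

open import Data.Nat using (ℕ; zero; suc; _+_; _*_; _∸_; NonZero)
open import Data.Nat.DivMod using (_%_)
open import Data.Nat.Divisibility using (_∣_)
open import Data.Fin using (Fin; toℕ)
open import Data.List using (List; length; filter)
open import Data.List using (allFin)
open import Relation.Binary.PropositionalEquality using (_≡_)
open import Relation.Nullary using (¬_)
open import Data.Nat using (_≟_)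

-- Elements of Z_v are represented by Fin v (i.e. naturals 0..v-1).
-- Subtraction in Z_v: (a - b) mod v, computed as (a + (v ∸ b)) % v.
-- (v = 0 is vacuous since Fin 0 is empty.)
subMod : (v : ℕ) → Fin v → Fin v → ℕ
subMod zero    () b
subMod (suc m) a b = (toℕ a + (suc m ∸ toℕ b)) % suc m

count : (n : ℕ) → (Fin n → ℕ) → ℕ → ℕ
count n f e = length (filter (λ j → f j ≟ e) (allFin n))

-- A (k, wt; w)-CHDM: a k × w(t-1) matrix D with entries in Z_{wt} such that
-- for any two distinct rows x, y, the list of differences d_xj - d_yj
-- (j = 0 .. w(t-1)-1) contains each element of Z_{wt} \ {0, t, ..., (w-1)t}
-- exactly once.  (Elements of the removed set are exactly the e < wt with t ∣ e.)
IsCHDM : (k w t : ℕ) →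
         (Fin k → Fin (w * (t ∸ 1)) → Fin (w * t)) → Set
IsCHDM k w t D =
  (x y : Fin k) → ¬ (x ≡ y) →
  (e : Fin (w * t)) → ¬ (t ∣ toℕ e) →
  count (w * (t ∸ 1)) (λ j → subMod (w * t) (D x j) (D y j)) (toℕ e) ≡ 1

-- Write N = 4t and h = 2t.  A starter is a list of 2(t − 1) pairs (x, y) of residues mod N such that
-- each of the lists of the x, of the y and of the differences y − x meets every class ±c with
-- c ∈ {1, …, h − 1} ∖ {t} exactly once.  The 3 × 4(t − 1) matrix with columns (0, x, y) and (0, −x, −y)
-- is then a CHDM: for two rows the differences along the columns form a list L ++ (−L), where L is one
-- of the three lists up to sign, so each residue that is not a multiple of t occurs exactly once.
-- For t = 4 + 2a and t = 5 + 2a a starter is assembled from blocks {(x + i, y + L − 1 − i) | i < L},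
-- whose coordinates and differences run through arithmetic progressions of step 1 or 2; explicit
-- families of six and eight blocks tile the required classes.

module Submission where

open import Defs
import Algebra.Solver.CommutativeMonoid as CommutativeMonoidSolver
open import Data.Bool using (true; false)
open import Data.Empty using (⊥-elim)
open import Data.Fin using (Fin; toℕ; zero; suc; cast)
open import Data.Fin.Properties using (toℕ-fromℕ<; toℕ<n; cast-is-id)
open import Data.List using (List; []; _∷_; _++_; [_]; map; length; filter; allFin; lookup; tabulate; zip; concat)
open import Data.List.Membership.Propositional using (_∈_)
open import Data.List.Membership.Propositional.Properties using (∈-++⁻; ∈-map⁺)
open import Data.List.Properties
  using (length-++; length-map; filter-++; filter-accept; filter-reject; map-cong-local; map-cong; map-id; map-∘; map-++;
         map-tabulate; tabulate-cong; tabulate-lookup)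
open import Data.List.Relation.Binary.Permutation.Propositional
  using (_↭_; ↭-refl; ↭-sym; ↭-trans; ↭-reflexive; prep; module PermutationReasoning)
open import Data.List.Relation.Binary.Permutation.Propositional.Properties
  using (↭-length; filter-↭; ∷↭∷ʳ; shift; ++⁺; ∈-resp-↭; All-resp-↭; ++-commutativeMonoid)
open import Data.List.Relation.Unary.All using (All)
import Data.List.Relation.Unary.All as All
open import Data.List.Relation.Unary.All.Properties using (map⁻; map⁺) renaming (++⁺ to All-++⁺)
open import Data.List.Relation.Unary.Any using (here; there)
open import Data.Nat using (ℕ; zero; suc; _+_; _*_; _∸_; _≤_; _<_; z≤n; s≤s; z<s; _≟_; _≡ᵇ_; _<?_; _≤?_; NonZero)
open import Data.Nat.Divisibility using (_∣_; divides)
open import Data.Nat.DivMod using (_%_; _mod_; m<n⇒m%n≡m; [m+n]%n≡m%n; %-distribˡ-+; m%n%n≡m%n; n%n≡0; m%n<n)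
open import Data.Nat.Properties
open import Algebra.Properties.CommutativeSemigroup +-commutativeSemigroup using (interchange)
open import Data.Nat.Tactic.RingSolver using (solve-∀; solve)
open import Data.Product using (Σ; ∃-syntax; _×_; _,_; proj₁; proj₂)
open import Data.Sum using (_⊎_; inj₁; inj₂)
open import Function using (_∘_)
open import Function.Definitions using (Injective)
open import Relation.Binary.Definitions using (tri<; tri≈; tri>)
open import Relation.Binary.PropositionalEquality
  using (_≡_; _≢_; refl; sym; trans; cong; cong₂; subst; subst₂; module ≡-Reasoning)
open import Relation.Nullary using (¬_; yes; no)

occ : ℕ → List ℕ → ℕ
occ c xs = length (filter (_≟ c) xs)

occ-++ : ∀ c xs ys → occ c (xs ++ ys) ≡ occ c xs + occ c ys
occ-++ c xs ys = trans (cong length (filter-++ (_≟ c) xs ys)) (length-++ (filter (_≟ c) xs))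

occ-↭ : ∀ c {xs ys} → xs ↭ ys → occ c xs ≡ occ c ys
occ-↭ c p = ↭-length (filter-↭ (_≟ c) p)

occ-here : ∀ {c v} xs → v ≡ c → occ c (v ∷ xs) ≡ suc (occ c xs)
occ-here {c} xs v≡c = cong length (filter-accept (_≟ c) v≡c)

occ-there : ∀ {c v} xs → v ≢ c → occ c (v ∷ xs) ≡ occ c xs
occ-there {c} xs v≢c = cong length (filter-reject (_≟ c) v≢c)

length-filter≡occ-map : ∀ {A : Set} (f : A → ℕ) e xs →
  length (filter (λ j → f j ≟ e) xs) ≡ occ e (map f xs)
length-filter≡occ-map f e [] = refl
length-filter≡occ-map f e (x ∷ xs) with f x ≡ᵇ e  -- _≟_ on ℕ decides through _≡ᵇ_
... | true = cong suc (length-filter≡occ-map f e xs)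
... | false = length-filter≡occ-map f e xs

occ-∉ : ∀ {c} xs → ¬ c ∈ xs → occ c xs ≡ 0
occ-∉ [] c∉ = refl
occ-∉ (v ∷ xs) c∉ = trans (occ-there xs (λ v≡c → c∉ (here (sym v≡c)))) (occ-∉ xs (λ c∈ → c∉ (there c∈)))

-- Arithmetic progressions

-- ap a s n = [a, a + s, …, a + (n − 1) s], and apᵈ a s n is the same list in decreasing order.
-- They are opaque so that instances of literal length are matched syntactically instead of unfolding.
opaque
  ap : ℕ → ℕ → ℕ → List ℕ
  ap a s zero = []
  ap a s (suc n) = a ∷ ap (a + s) s n

  apᵈ : ℕ → ℕ → ℕ → List ℕ
  apᵈ a s zero = []
  apᵈ a s (suc n) = a + n * s ∷ apᵈ a s n

  length-ap : ∀ a s n → length (ap a s n) ≡ n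
  length-ap a s zero = refl
  length-ap a s (suc n) = cong suc (length-ap (a + s) s n)

  ap-++ : ∀ a s m n → ap a s m ++ ap (a + m * s) s n ≡ ap a s (m + n)
  ap-++ a s zero n = cong (λ b → ap b s n) (+-identityʳ a)
  ap-++ a s (suc m) n = cong (a ∷_) (begin
      ap (a + s) s m ++ ap (a + (s + m * s)) s n  ≡⟨ cong (λ b → ap (a + s) s m ++ ap b s n) (+-assoc a s (m * s)) ⟨
      ap (a + s) s m ++ ap (a + s + m * s) s n    ≡⟨ ap-++ (a + s) s m n ⟩
      ap (a + s) s (m + n)                        ∎)
    where open ≡-Reasoning

  ap-join : ∀ {a s m n b k} → a + m * s ≡ b → m + n ≡ k → ap a s m ++ ap b s n ≡ ap a s k
  ap-join {a} {s} {m} {n} refl refl = ap-++ a s m n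

  apᵈ↭ap : ∀ a s n → apᵈ a s n ↭ ap a s n
  apᵈ↭ap a s zero = ↭-refl
  apᵈ↭ap a s (suc n) = begin
      a + n * s ∷ apᵈ a s n    ↭⟨ prep (a + n * s) (apᵈ↭ap a s n) ⟩
      a + n * s ∷ ap a s n     ↭⟨ ∷↭∷ʳ (a + n * s) (ap a s n) ⟩
      ap a s n ++ [ a + n * s ] ≡⟨ ap-join {m = n} {n = 1} refl (+-comm n 1) ⟩
      ap a s (suc n)           ∎
    where open PermutationReasoning

  ap-interleave : ∀ {a b e n m k} → e ≤ 1 → e + n + n ≡ k → e + n ≡ m → a + 1 ≡ b →
                  ap a 1 k ↭ ap a 2 m ++ ap b 2 n
  ap-interleave {a} {e = e} {n} e≤1 refl refl refl = interleave a e n e≤1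
    where
    interleave : ∀ a e n → e ≤ 1 → ap a 1 (e + n + n) ↭ ap a 2 (e + n) ++ ap (a + 1) 2 n
    interleave a zero zero _ = ↭-refl
    interleave a (suc zero) zero _ = ↭-refl
    interleave a (suc (suc _)) zero (s≤s ())
    interleave a e (suc n) e≤1 = begin
        ap a 1 (e + suc n + suc n)
          ≡⟨ cong (ap a 1) (arith e n) ⟩
        a ∷ a + 1 ∷ ap (a + 1 + 1) 1 (e + n + n)
          ↭⟨ prep a (prep (a + 1) (interleave (a + 1 + 1) e n e≤1)) ⟩
        a ∷ a + 1 ∷ ap (a + 1 + 1) 2 (e + n) ++ ap (a + 1 + 1 + 1) 2 n
          ≡⟨ cong₂ (λ b c → a ∷ a + 1 ∷ ap b 2 (e + n) ++ ap c 2 n) (+-assoc a 1 1) (+-assoc (a + 1) 1 1) ⟩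
        a ∷ a + 1 ∷ ap (a + 2) 2 (e + n) ++ ap (a + 1 + 2) 2 n
          ↭⟨ prep a (shift (a + 1) (ap (a + 2) 2 (e + n)) (ap (a + 1 + 2) 2 n)) ⟨
        ap a 2 (suc (e + n)) ++ ap (a + 1) 2 (suc n)
          ≡⟨ cong (λ m → ap a 2 m ++ ap (a + 1) 2 (suc n)) (+-suc e n) ⟨
        ap a 2 (e + suc n) ++ ap (a + 1) 2 (suc n)
          ∎
      where
      open PermutationReasoning
      arith : ∀ e n → e + suc n + suc n ≡ suc (suc (e + n + n))
      arith = solve-∀

  ∈-ap⁻ : ∀ {c} a s n → c ∈ ap a s n → a ≤ c × c + s ≤ a + n * s
  ∈-ap⁻ a s (suc n) (here refl) = ≤-refl , +-monoʳ-≤ a (m≤m+n s (n * s))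
  ∈-ap⁻ {c} a s (suc n) (there c∈) with ∈-ap⁻ (a + s) s n c∈
  ... | a+s≤c , c+s≤ = ≤-trans (m≤m+n a s) a+s≤c , ≤-trans c+s≤ (≤-reflexive (+-assoc a s (n * s)))

  occ-ap-in : ∀ {c} a n → a ≤ c → c < a + n → occ c (ap a 1 n) ≡ 1
  occ-ap-in {c} a zero a≤c c<a+0 = ⊥-elim (<⇒≱ c<a+0 (subst (_≤ c) (sym (+-identityʳ a)) a≤c))
  occ-ap-in {c} a (suc n) a≤c c<a+1+n with a ≟ c
  ... | yes a≡c = trans (occ-here (ap (a + 1) 1 n) a≡c) (cong suc (occ-∉ (ap (a + 1) 1 n) c∉))
    where
    c∉ : ¬ c ∈ ap (a + 1) 1 n
    c∉ c∈ = <⇒≱ (m<m+n a z<s) (subst (a + 1 ≤_) (sym a≡c) (proj₁ (∈-ap⁻ (a + 1) 1 n c∈)))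
  ... | no a≢c = trans (occ-there (ap (a + 1) 1 n) a≢c) (occ-ap-in (a + 1) n a+1≤c c<a+1+n′)
    where
    a+1≤c : a + 1 ≤ c
    a+1≤c = subst (_≤ c) (+-comm 1 a) (≤∧≢⇒< a≤c a≢c)
    c<a+1+n′ : c < a + 1 + n
    c<a+1+n′ = subst (c <_) (sym (+-assoc a 1 n)) c<a+1+n

  map-∸-apᵈ : ∀ N {y s z} L → y + L * s + z ≡ N + s → map (N ∸_) (apᵈ y s L) ≡ ap z s L
  map-∸-apᵈ N zero eq = refl
  map-∸-apᵈ N {y} {s} {z} (suc n) eq = cong₂ _∷_ head (map-∸-apᵈ N n tail)
    where
    top : y + n * s + z ≡ N
    top = +-cancelʳ-≡ s _ _ (trans (arith y n s z) eq)
      where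
      arith : ∀ y n s z → y + n * s + z + s ≡ y + suc n * s + z
      arith = solve-∀
    head : N ∸ (y + n * s) ≡ z
    head = trans (cong (_∸ (y + n * s)) (sym top)) (m+n∸m≡n (y + n * s) z)
    tail : y + n * s + (z + s) ≡ N + s
    tail = trans (sym (+-assoc (y + n * s) z s)) (cong (_+ s) top)

  block : ℕ → ℕ → ℕ → List (ℕ × ℕ)
  block x y L = zip (ap x 1 L) (apᵈ y 1 L)

  map-proj₁-block : ∀ x y L → map proj₁ (block x y L) ≡ ap x 1 L
  map-proj₁-block x y zero = refl
  map-proj₁-block x y (suc n) = cong (x ∷_) (map-proj₁-block (x + 1) y n)

  map-proj₂-block : ∀ x y L → map proj₂ (block x y L) ≡ apᵈ y 1 L
  map-proj₂-block x y zero = refl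
  map-proj₂-block x y (suc n) = cong (y + n * 1 ∷_) (map-proj₂-block (x + 1) y n)

ap-bounded : ∀ {a s n b} → a + n * s ≤ b + s → All (_≤ b) (ap a s n)
ap-bounded {a} {s} {n} {b} end≤ =
  All.tabulate (λ {c} c∈ → +-cancelʳ-≤ s c b (≤-trans (proj₂ (∈-ap⁻ a s n c∈)) end≤))

ap-above : ∀ {a s n b} → b < a → All (b <_) (ap a s n)
ap-above {a} {s} {n} b<a = All.tabulate (λ c∈ → <-≤-trans b<a (proj₁ (∈-ap⁻ a s n c∈)))

apᵈ-All : ∀ {P : ℕ → Set} {a s n} → All P (ap a s n) → All P (apᵈ a s n)
apᵈ-All {a = a} {s} {n} = All-resp-↭ (↭-sym (apᵈ↭ap a s n))

subMod-mod : ∀ N .{{_ : NonZero N}} a b → subMod N (a mod N) (b mod N) ≡ (a % N + (N ∸ b % N)) % N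
subMod-mod (suc m) a b =
  cong₂ (λ u v → (u + (suc m ∸ v)) % suc m) (toℕ-fromℕ< (m%n<n a (suc m))) (toℕ-fromℕ< (m%n<n b (suc m)))

module CyclicDifference (N : ℕ) .{{_ : NonZero N}} where

  infixl 6 _⊖_
  _⊖_ : ℕ → ℕ → ℕ
  b ⊖ a = (b + (N ∸ a)) % N

  ⊖-≡ : ∀ {a b v} → a + v ≡ b → b < N → b ⊖ a ≡ v
  ⊖-≡ {a} {_} {v} refl a+v<N = begin
      (a + v + (N ∸ a)) % N    ≡⟨ cong (_% N) (cong (_+ (N ∸ a)) (+-comm a v)) ⟩
      (v + a + (N ∸ a)) % N    ≡⟨ cong (_% N) (+-assoc v a (N ∸ a)) ⟩
      (v + (a + (N ∸ a))) % N  ≡⟨ cong (λ m → (v + m) % N) (m+[n∸m]≡n a≤N) ⟩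
      (v + N) % N              ≡⟨ [m+n]%n≡m%n v N ⟩
      v % N                    ≡⟨ m<n⇒m%n≡m (≤-<-trans (m≤n+m v a) a+v<N) ⟩
      v                        ∎
    where
    open ≡-Reasoning
    a≤N : a ≤ N
    a≤N = ≤-trans (m≤m+n a v) (<⇒≤ a+v<N)

  ⊖-wrap : ∀ {a b w} → b + w ≡ a → a ≤ N → 0 < w → b ⊖ a ≡ N ∸ w
  ⊖-wrap {_} {b} {w} refl b+w≤N 0<w = begin
      (b + (N ∸ (b + w))) % N  ≡⟨ cong (λ m → (b + (N ∸ m)) % N) (+-comm b w) ⟩
      (b + (N ∸ (w + b))) % N  ≡⟨ cong (λ m → (b + m) % N) (∸-+-assoc N w b) ⟨
      (b + (N ∸ w ∸ b)) % N    ≡⟨ cong (_% N) (m+[n∸m]≡n (m+n≤o⇒m≤o∸n b b+w≤N)) ⟩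
      (N ∸ w) % N              ≡⟨ m<n⇒m%n≡m (∸-monoʳ-< 0<w (m+n≤o⇒n≤o b b+w≤N)) ⟩
      N ∸ w                    ∎
    where open ≡-Reasoning

  ⊖-self : ∀ {a} → a ≤ N → a ⊖ a ≡ 0
  ⊖-self a≤N = trans (cong (_% N) (m+[n∸m]≡n a≤N)) (n%n≡0 N)

  ⊖-anticomm : ∀ {a b} → a < N → b < N → a ≢ b → a ⊖ b ≡ N ∸ (b ⊖ a)
  ⊖-anticomm {a} {b} a<N b<N a≢b with <-cmp a b
  ... | tri< a<b _ _ = begin
      a ⊖ b            ≡⟨ ⊖-wrap {w = b ∸ a} (m+[n∸m]≡n (<⇒≤ a<b)) (<⇒≤ b<N) (m<n⇒0<n∸m a<b) ⟩
      N ∸ (b ∸ a)      ≡⟨ cong (N ∸_) (⊖-≡ {v = b ∸ a} (m+[n∸m]≡n (<⇒≤ a<b)) b<N) ⟨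
      N ∸ (b ⊖ a)      ∎
    where open ≡-Reasoning
  ... | tri≈ _ a≡b _ = ⊥-elim (a≢b a≡b)
  ... | tri> _ _ b<a = begin
      a ⊖ b            ≡⟨ ⊖-≡ {v = a ∸ b} (m+[n∸m]≡n (<⇒≤ b<a)) a<N ⟩
      a ∸ b            ≡⟨ m∸[m∸n]≡n (≤-trans (m∸n≤m a b) (<⇒≤ a<N)) ⟨
      N ∸ (N ∸ (a ∸ b)) ≡⟨ cong (N ∸_) (⊖-wrap {w = a ∸ b} (m+[n∸m]≡n (<⇒≤ b<a)) (<⇒≤ a<N) (m<n⇒0<n∸m b<a))
                         ⟨
      N ∸ (b ⊖ a)      ∎
    where open ≡-Reasoning

  ⊖-∸∸ : ∀ a {b} → b ≤ N → (N ∸ a) ⊖ (N ∸ b) ≡ b ⊖ a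
  ⊖-∸∸ a {b} b≤N = cong (_% N) (trans (cong ((N ∸ a) +_) (m∸[m∸n]≡n b≤N)) (+-comm (N ∸ a) b))

  ⊖-mod : ∀ {a b} → b ≤ N → (a % N + (N ∸ b % N)) % N ≡ a ⊖ b
  ⊖-mod {a} {b} b≤N = trans (reduceˡ a (N ∸ b % N)) (reduceʳ b≤N)
    where
    reduceˡ : ∀ m k → (m % N + k) % N ≡ (m + k) % N
    reduceˡ m k = begin
      (m % N + k) % N            ≡⟨ %-distribˡ-+ (m % N) k N ⟩
      (m % N % N + k % N) % N    ≡⟨ cong (λ r → (r + k % N) % N) (m%n%n≡m%n m N) ⟩
      (m % N + k % N) % N        ≡⟨ %-distribˡ-+ m k N ⟨
      (m + k) % N                ∎
      where open ≡-Reasoning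
    reduceʳ : ∀ {b} → b ≤ N → (a + (N ∸ b % N)) % N ≡ a ⊖ b
    reduceʳ {b} b≤N with m≤n⇒m<n∨m≡n b≤N
    ... | inj₁ b<N = cong (λ r → (a + (N ∸ r)) % N) (m<n⇒m%n≡m b<N)
    ... | inj₂ refl = begin
      (a + (N ∸ N % N)) % N  ≡⟨ cong (λ r → (a + (N ∸ r)) % N) (n%n≡0 N) ⟩
      (a + N) % N            ≡⟨ [m+n]%n≡m%n a N ⟩
      a % N                  ≡⟨ cong (_% N) (trans (cong (a +_) (n∸n≡0 N)) (+-identityʳ a)) ⟨
      (a + (N ∸ N)) % N      ∎
      where open ≡-Reasoning

-- The classes ±v modulo N = h + h

m+m≡n+n⇒m≡n : ∀ {m n} → m + m ≡ n + n → m ≡ n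
m+m≡n+n⇒m≡n {m} {n} eq with <-cmp m n
... | tri< m<n _ _ = ⊥-elim (<⇒≢ (+-mono-< m<n m<n) eq)
... | tri≈ _ m≡n _ = m≡n
... | tri> _ _ n<m = ⊥-elim (<⇒≢ (+-mono-< n<m n<m) (sym eq))

module AbsoluteValue (N h : ℕ) (N≡h+h : N ≡ h + h) where

  -- For v ≤ N, abs v is the representative of {v, N − v} in [0, h]; larger v are sent to 0.
  abs : ℕ → ℕ
  abs v with v ≤? h
  ... | yes _ = v
  ... | no _ = N ∸ v

  abs-≤ : ∀ {v} → v ≤ h → abs v ≡ v
  abs-≤ {v} v≤h with v ≤? h
  ... | yes _ = refl
  ... | no v≰h = ⊥-elim (v≰h v≤h)

  abs-> : ∀ {v} → h < v → abs v ≡ N ∸ v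
  abs-> {v} h<v with v ≤? h
  ... | yes v≤h = ⊥-elim (<⇒≱ h<v v≤h)
  ... | no _ = refl

  N∸h≡h : N ∸ h ≡ h
  N∸h≡h = trans (cong (_∸ h) N≡h+h) (m+n∸n≡m h h)

  abs-∸ : ∀ {v} → v ≤ N → abs (N ∸ v) ≡ abs v
  abs-∸ {v} v≤N with ≤-<-connex v h
  ... | inj₂ h<v = trans (abs-≤ (subst (N ∸ v ≤_) N∸h≡h (∸-monoʳ-≤ N (<⇒≤ h<v)))) (sym (abs-> h<v))
  ... | inj₁ v≤h with ≤-<-connex (N ∸ v) h
  ...   | inj₂ h<N∸v = trans (abs-> h<N∸v) (trans (m∸[m∸n]≡n v≤N) (sym (abs-≤ v≤h)))
  ...   | inj₁ N∸v≤h = trans (abs-≤ N∸v≤h) (trans N∸v≡h (trans (sym v≡h) (sym (abs-≤ v≤h))))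
    where
    N∸v≡h : N ∸ v ≡ h
    N∸v≡h = ≤-antisym N∸v≤h (subst (_≤ N ∸ v) N∸h≡h (∸-monoʳ-≤ N v≤h))
    v≡h : v ≡ h
    v≡h = trans (sym (m∸[m∸n]≡n v≤N)) (trans (cong (N ∸_) N∸v≡h) N∸h≡h)

  abs-inv : ∀ {v e} → v ≤ N → e ≤ N → abs v ≡ abs e → v ≡ e ⊎ v ≡ N ∸ e
  abs-inv {v} {e} v≤N e≤N eq with ≤-<-connex v h | ≤-<-connex e h
  ... | inj₁ v≤h | inj₁ e≤h = inj₁ (trans (sym (abs-≤ v≤h)) (trans eq (abs-≤ e≤h)))
  ... | inj₁ v≤h | inj₂ h<e = inj₂ (trans (sym (abs-≤ v≤h)) (trans eq (abs-> h<e)))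
  ... | inj₂ h<v | inj₁ e≤h =
    inj₂ (trans (sym (m∸[m∸n]≡n v≤N)) (cong (N ∸_) (trans (sym (abs-> h<v)) (trans eq (abs-≤ e≤h)))))
  ... | inj₂ h<v | inj₂ h<e =
    inj₁ (∸-cancelˡ-≡ v≤N e≤N (trans (sym (abs-> h<v)) (trans eq (abs-> h<e))))

  abs-pos : ∀ {v} → 0 < abs v → 0 < v × v < N
  abs-pos {v} 0<abs with ≤-<-connex v h
  ... | inj₁ v≤h = 0<v , subst (v <_) (sym N≡h+h) (≤-<-trans v≤h (m<m+n h (<-≤-trans 0<v v≤h)))
    where
    0<v : 0 < v
    0<v = subst (0 <_) (abs-≤ v≤h) 0<abs
  ... | inj₂ h<v = <-≤-trans z<s h<v , v<N
    where
    v<N : v < N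
    v<N with v <? N
    ... | yes v<N = v<N
    ... | no v≮N = ⊥-elim (<⇒≢ (subst (0 <_) (abs-> h<v) 0<abs) (sym (m≤n⇒m∸n≡0 (≮⇒≥ v≮N))))

  occ-±-[_] : ∀ {e} v → v ≤ N → e ≤ N → e ≢ h → occ e [ v ] + occ e [ N ∸ v ] ≡ occ (abs e) [ abs v ]
  occ-±-[_] {e} v v≤N e≤N e≢h with v ≟ e
  ... | yes refl = trans (cong₂ _+_ (occ-here {e} [] refl) (occ-∉ [ N ∸ v ] N∸v≢v)) (sym (occ-here {abs e} [] refl))
    where
    N∸v≢v : ¬ v ∈ [ N ∸ v ]
    N∸v≢v (here v≡N∸v) = e≢h (m+m≡n+n⇒m≡n (trans (cong (v +_) v≡N∸v) (trans (m+[n∸m]≡n v≤N) N≡h+h)))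
  ... | no v≢e with N ∸ v ≟ e
  ...   | yes N∸v≡e = trans (cong₂ _+_ (occ-there {e} [] v≢e) (occ-here {e} [] N∸v≡e))
                              (sym (occ-here {abs e} [] (trans (sym (abs-∸ v≤N)) (cong abs N∸v≡e))))
  ...   | no N∸v≢e = trans (cong₂ _+_ (occ-there [] v≢e) (occ-there [] N∸v≢e)) (sym (occ-there [] abs≢))
    where
    abs≢ : abs v ≢ abs e
    abs≢ eq with abs-inv v≤N e≤N eq
    ... | inj₁ v≡e = v≢e v≡e
    ... | inj₂ v≡N∸e = N∸v≢e (trans (cong (N ∸_) v≡N∸e) (m∸[m∸n]≡n e≤N))

  occ-± : ∀ {e} xs → All (_≤ N) xs → e ≤ N → e ≢ h →
          occ e xs + occ e (map (N ∸_) xs) ≡ occ (abs e) (map abs xs)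
  occ-± [] All.[] _ _ = refl
  occ-± {e} (v ∷ xs) (v≤N All.∷ xs≤N) e≤N e≢h = begin
      occ e (v ∷ xs) + occ e (N ∸ v ∷ map (N ∸_) xs)
        ≡⟨ cong₂ _+_ (occ-++ e [ v ] xs) (occ-++ e [ N ∸ v ] (map (N ∸_) xs)) ⟩
      (occ e [ v ] + occ e xs) + (occ e [ N ∸ v ] + occ e (map (N ∸_) xs))
        ≡⟨ interchange (occ e [ v ]) (occ e xs) (occ e [ N ∸ v ]) (occ e (map (N ∸_) xs)) ⟩
      (occ e [ v ] + occ e [ N ∸ v ]) + (occ e xs + occ e (map (N ∸_) xs))
        ≡⟨ cong₂ _+_ (occ-±-[ v ] v≤N e≤N e≢h) (occ-± xs xs≤N e≤N e≢h) ⟩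
      occ (abs e) [ abs v ] + occ (abs e) (map abs xs)
        ≡⟨ occ-++ (abs e) [ abs v ] (map abs xs) ⟨
      occ (abs e) (abs v ∷ map abs xs)
        ∎
    where open ≡-Reasoning

  map-abs-≤ : ∀ {xs} → All (_≤ h) xs → map abs xs ≡ xs
  map-abs-≤ {xs} xs≤h = trans (map-cong-local (All.map abs-≤ xs≤h)) (map-id xs)

  map-abs-> : ∀ {xs} → All (h <_) xs → map abs xs ≡ map (N ∸_) xs
  map-abs-> xs>h = map-cong-local (All.map abs-> xs>h)

  map-abs-∸ : ∀ {xs} → All (_≤ N) xs → map abs (map (N ∸_) xs) ≡ map abs xs
  map-abs-∸ {xs} xs≤N = trans (sym (map-∘ xs)) (map-cong-local (All.map abs-∸ xs≤N))

-- Starters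

map-lookup-allFin : ∀ {A B : Set} (f : A → B) (xs : List A) {n} (eq : n ≡ length xs) →
  map (λ j → f (lookup xs (cast eq j))) (allFin n) ≡ map f xs
map-lookup-allFin f xs refl = begin
    map (λ j → f (lookup xs (cast refl j))) (tabulate (λ j → j))
      ≡⟨ map-tabulate (λ j → j) _ ⟩
    tabulate (λ j → f (lookup xs (cast refl j)))
      ≡⟨ tabulate-cong (λ j → cong (λ k → f (lookup xs k)) (cast-is-id refl j)) ⟩
    tabulate (λ j → f (lookup xs j))
      ≡⟨ map-tabulate (lookup xs) f ⟨
    map f (tabulate (lookup xs))
      ≡⟨ cong (map f) (tabulate-lookup xs) ⟩
    map f xs
      ∎
  where open ≡-Reasoning

4*m≡[m+m]+[m+m] : ∀ m → 4 * m ≡ (m + m) + (m + m)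
4*m≡[m+m]+[m+m] = solve-∀

CHDM : ℕ → Set
CHDM t = Σ (Fin 3 → Fin (4 * (t ∸ 1)) → Fin (4 * t)) (IsCHDM 3 4 t)

module Starters (t : ℕ) .{{_ : NonZero t}} where

  private instance
    4t-nonZero : NonZero (4 * t)
    4t-nonZero = m*n≢0 4 t

  open CyclicDifference (4 * t) public
  open AbsoluteValue (4 * t) (t + t) (4*m≡[m+m]+[m+m] t) public

  1+[t∸1]≡t : 1 + (t ∸ 1) ≡ t
  1+[t∸1]≡t = suc-pred t

  -- One representative of each class ±c of residues mod 4t that are not multiples of t.
  halfResidues : List ℕ
  halfResidues = ap 1 1 (t ∸ 1) ++ ap (suc t) 1 (t ∸ 1)

  length-halfResidues : length halfResidues ≡ (t ∸ 1) + (t ∸ 1)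
  length-halfResidues =
    trans (length-++ (ap 1 1 (t ∸ 1))) (cong₂ _+_ (length-ap 1 1 (t ∸ 1)) (length-ap (suc t) 1 (t ∸ 1)))

  ∈-halfResidues⁻ : ∀ {c} → c ∈ halfResidues → 0 < c
  ∈-halfResidues⁻ c∈ with ∈-++⁻ (ap 1 1 (t ∸ 1)) c∈
  ... | inj₁ c∈ˡ = proj₁ (∈-ap⁻ 1 1 (t ∸ 1) c∈ˡ)
  ... | inj₂ c∈ʳ = <-≤-trans z<s (proj₁ (∈-ap⁻ (suc t) 1 (t ∸ 1) c∈ʳ))

  HalfResidue : ℕ → Set
  HalfResidue c = 0 < c × c < t + t × c ≢ t

  occ-halfResidues : ∀ {c} → HalfResidue c → occ c halfResidues ≡ 1
  occ-halfResidues {c} (0<c , c<2t , c≢t) with <-cmp c t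
  ... | tri< c<t _ _ = trans (occ-++ c (ap 1 1 (t ∸ 1)) _)
      (cong₂ _+_ (occ-ap-in 1 (t ∸ 1) 0<c (subst (c <_) (sym 1+[t∸1]≡t) c<t)) (occ-∉ _ c∉))
    where
    c∉ : ¬ c ∈ ap (suc t) 1 (t ∸ 1)
    c∉ c∈ = <-asym c<t (proj₁ (∈-ap⁻ (suc t) 1 (t ∸ 1) c∈))
  ... | tri≈ _ c≡t _ = ⊥-elim (c≢t c≡t)
  ... | tri> _ _ t<c = trans (occ-++ c (ap 1 1 (t ∸ 1)) _)
      (cong₂ _+_ (occ-∉ _ c∉) (occ-ap-in (suc t) (t ∸ 1) t<c (subst (c <_) (sym 1+t+[t∸1]≡t+t) c<2t)))
    where
    1+t+[t∸1]≡t+t : suc t + (t ∸ 1) ≡ t + t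
    1+t+[t∸1]≡t+t = trans (sym (+-suc t (t ∸ 1))) (cong (t +_) 1+[t∸1]≡t)
    c∉ : ¬ c ∈ ap 1 1 (t ∸ 1)
    c∉ c∈ = <-asym t<c (subst₂ _≤_ (+-comm c 1) top (proj₂ (∈-ap⁻ 1 1 (t ∸ 1) c∈)))
      where
      top : 1 + (t ∸ 1) * 1 ≡ t
      top = trans (cong (1 +_) (*-identityʳ (t ∸ 1))) 1+[t∸1]≡t

  Covers : List ℕ → Set
  Covers xs = map abs xs ↭ halfResidues

  NonzeroResidue : ℕ → Set
  NonzeroResidue v = 0 < v × v < 4 * t

  covers⇒residues : ∀ {xs} → Covers xs → All NonzeroResidue xs
  covers⇒residues cover = All.tabulate (λ v∈ → abs-pos (∈-halfResidues⁻ (∈-resp-↭ cover (∈-map⁺ abs v∈))))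

  covers⇒≤4t : ∀ {xs} → Covers xs → All (_≤ 4 * t) xs
  covers⇒≤4t cover = All.map (λ r → <⇒≤ (proj₂ r)) (covers⇒residues cover)

  covers-∸ : ∀ {xs} → Covers xs → Covers (map (4 * t ∸_) xs)
  covers-∸ cover = subst (_↭ halfResidues) (sym (map-abs-∸ (covers⇒≤4t cover))) cover

  ≢-multiple : ∀ {e} → ¬ t ∣ e → ∀ k {m} → m ≡ k * t → e ≢ m
  ≢-multiple t∤e k m≡kt e≡m = t∤e (divides k (trans e≡m m≡kt))

  ≢2t : ∀ {e} → ¬ t ∣ e → e ≢ t + t
  ≢2t t∤e = ≢-multiple t∤e 2 (cong (t +_) (sym (+-identityʳ t)))

  abs-nonmultiple : ∀ {e} → e < 4 * t → ¬ t ∣ e → HalfResidue (abs e)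
  abs-nonmultiple {e} e<4t t∤e with ≤-<-connex e (t + t)
  ... | inj₁ e≤2t = subst HalfResidue (sym (abs-≤ e≤2t))
      (n≢0⇒n>0 (≢-multiple t∤e 0 refl) , ≤∧≢⇒< e≤2t (≢2t t∤e) , ≢-multiple t∤e 1 (sym (+-identityʳ t)))
  ... | inj₂ 2t<e = subst HalfResidue (sym (abs-> 2t<e))
      (m<n⇒0<n∸m e<4t , subst (4 * t ∸ e <_) N∸h≡h (∸-monoʳ-< 2t<e (<⇒≤ e<4t)) , 4t∸e≢t)
    where
    4t∸e≢t : 4 * t ∸ e ≢ t
    4t∸e≢t eq = ≢-multiple t∤e 3 refl (begin
      e                   ≡⟨ m∸[m∸n]≡n (<⇒≤ e<4t) ⟨
      4 * t ∸ (4 * t ∸ e) ≡⟨ cong (4 * t ∸_) eq ⟩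
      4 * t ∸ t           ≡⟨ m+n∸m≡n t (3 * t) ⟩
      3 * t               ∎)
      where open ≡-Reasoning

  covers-count : ∀ {L e} → Covers L → e < 4 * t → ¬ t ∣ e → occ e (L ++ map (4 * t ∸_) L) ≡ 1
  covers-count {L} {e} cover e<4t t∤e = begin
      occ e (L ++ map (4 * t ∸_) L)         ≡⟨ occ-++ e L (map (4 * t ∸_) L) ⟩
      occ e L + occ e (map (4 * t ∸_) L)    ≡⟨ occ-± L (covers⇒≤4t cover) (<⇒≤ e<4t) (≢2t t∤e) ⟩
      occ (abs e) (map abs L)               ≡⟨ occ-↭ (abs e) cover ⟩
      occ (abs e) halfResidues              ≡⟨ occ-halfResidues (abs-nonmultiple e<4t t∤e) ⟩
      1                                     ∎
    where open ≡-Reasoning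

  δ : ℕ × ℕ → ℕ
  δ (x , y) = y ⊖ x

  record Starter : Set where
    field
      pairs    : List (ℕ × ℕ)
      xs-cover : Covers (map proj₁ pairs)
      ys-cover : Covers (map proj₂ pairs)
      δ-cover  : Covers (map δ pairs)

  column : ℕ × ℕ → Fin 3 → ℕ
  column _       zero             = 0
  column (x , _) (suc zero)       = x
  column (_ , y) (suc (suc zero)) = y

  negate : (Fin 3 → ℕ) → Fin 3 → ℕ
  negate c i = 4 * t ∸ c i

  rowDiff : Fin 3 → Fin 3 → ℕ × ℕ → ℕ
  rowDiff i j p = column p i ⊖ column p j

  ProperColumn : (Fin 3 → ℕ) → Set
  ProperColumn c = (∀ i → c i < 4 * t) × Injective _≡_ _≡_ c

  column-proper : ∀ {x y} → NonzeroResidue x → NonzeroResidue y → NonzeroResidue (y ⊖ x) →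
                  ProperColumn (column (x , y))
  column-proper {x} {y} (0<x , x<4t) (0<y , y<4t) (0<y⊖x , _) = entries , injective
    where
    entries : ∀ i → column (x , y) i < 4 * t
    entries zero             = <-trans 0<x x<4t
    entries (suc zero)       = x<4t
    entries (suc (suc zero)) = y<4t
    x≢y : x ≢ y
    x≢y refl = <⇒≢ 0<y⊖x (sym (⊖-self (<⇒≤ y<4t)))
    injective : Injective _≡_ _≡_ (column (x , y))
    injective {zero}           {zero}           _   = refl
    injective {zero}           {suc zero}       0≡x = ⊥-elim (<⇒≢ 0<x 0≡x)
    injective {zero}           {suc (suc zero)} 0≡y = ⊥-elim (<⇒≢ 0<y 0≡y)
    injective {suc zero}       {zero}           x≡0 = ⊥-elim (<⇒≢ 0<x (sym x≡0))
    injective {suc zero}       {suc zero}       _   = refl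
    injective {suc zero}       {suc (suc zero)} x≡y = ⊥-elim (x≢y x≡y)
    injective {suc (suc zero)} {zero}           y≡0 = ⊥-elim (<⇒≢ 0<y (sym y≡0))
    injective {suc (suc zero)} {suc zero}       y≡x = ⊥-elim (x≢y (sym y≡x))
    injective {suc (suc zero)} {suc (suc zero)} _   = refl

  negate-⊖ : ∀ {c i j} → ProperColumn c → i ≢ j → negate c i ⊖ negate c j ≡ 4 * t ∸ (c i ⊖ c j)
  negate-⊖ {c} {i} {j} (c<4t , injective) i≢j =
    trans (⊖-∸∸ (c i) (<⇒≤ (c<4t j))) (⊖-anticomm (c<4t j) (c<4t i) (λ eq → i≢j (injective (sym eq))))

  module _ (S : Starter) where
    open Starter S

    proper : All (ProperColumn ∘ column) pairs
    proper = All.zipWith (λ (rx , ry , rδ) → column-proper rx ry rδ)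
      (map⁻ (covers⇒residues xs-cover) , All.zip (map⁻ (covers⇒residues ys-cover) , map⁻ (covers⇒residues δ-cover)))

    rowDiff-swap : ∀ {i j} → i ≢ j → map (rowDiff j i) pairs ≡ map (4 * t ∸_) (map (rowDiff i j) pairs)
    rowDiff-swap {i} {j} i≢j = trans (map-cong-local (All.map anticomm proper)) (map-∘ pairs)
      where
      anticomm : ∀ {p} → ProperColumn (column p) → rowDiff j i p ≡ 4 * t ∸ rowDiff i j p
      anticomm (c<4t , injective) = ⊖-anticomm (c<4t j) (c<4t i) (λ eq → i≢j (sym (injective eq)))

    covers-swap : ∀ {i j} → i ≢ j → Covers (map (rowDiff i j) pairs) → Covers (map (rowDiff j i) pairs)
    covers-swap i≢j cover = subst Covers (sym (rowDiff-swap i≢j)) (covers-∸ cover)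

    covers-zeroʳ : ∀ {f} → Covers (map f pairs) → All (λ p → f p < 4 * t) pairs →
                   Covers (map (λ p → f p ⊖ 0) pairs)
    covers-zeroʳ cover f<4t = subst Covers (map-cong-local (All.map (λ f<4t → sym (⊖-≡ refl f<4t)) f<4t)) cover

    covers-rowDiff₁₀ : Covers (map (rowDiff (suc zero) zero) pairs)
    covers-rowDiff₁₀ = covers-zeroʳ xs-cover (All.map proj₂ (map⁻ (covers⇒residues xs-cover)))

    covers-rowDiff₂₀ : Covers (map (rowDiff (suc (suc zero)) zero) pairs)
    covers-rowDiff₂₀ = covers-zeroʳ ys-cover (All.map proj₂ (map⁻ (covers⇒residues ys-cover)))

    covers-rowDiff : ∀ i j → i ≢ j → Covers (map (rowDiff i j) pairs)
    covers-rowDiff zero             zero             i≢j = ⊥-elim (i≢j refl)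
    covers-rowDiff zero             (suc zero)       i≢j = covers-swap (i≢j ∘ sym) covers-rowDiff₁₀
    covers-rowDiff zero             (suc (suc zero)) i≢j = covers-swap (i≢j ∘ sym) covers-rowDiff₂₀
    covers-rowDiff (suc zero)       zero             _   = covers-rowDiff₁₀
    covers-rowDiff (suc zero)       (suc zero)       i≢j = ⊥-elim (i≢j refl)
    covers-rowDiff (suc zero)       (suc (suc zero)) i≢j = covers-swap (i≢j ∘ sym) δ-cover
    covers-rowDiff (suc (suc zero)) zero             _   = covers-rowDiff₂₀
    covers-rowDiff (suc (suc zero)) (suc zero)       _   = δ-cover
    covers-rowDiff (suc (suc zero)) (suc (suc zero)) i≢j = ⊥-elim (i≢j refl)

    -- negate (column p) starts with 4t rather than 0; D reduces its entries mod 4t (see ⊖-mod).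
    columns : List (Fin 3 → ℕ)
    columns = map column pairs ++ map (negate ∘ column) pairs

    length-columns : 4 * (t ∸ 1) ≡ length columns
    length-columns = begin
      4 * (t ∸ 1)
        ≡⟨ 4*m≡[m+m]+[m+m] (t ∸ 1) ⟩
      ((t ∸ 1) + (t ∸ 1)) + ((t ∸ 1) + (t ∸ 1))
        ≡⟨ cong (λ m → m + m) length-pairs ⟨
      length pairs + length pairs
        ≡⟨ cong₂ _+_ (length-map column pairs) (length-map (negate ∘ column) pairs) ⟨
      length (map column pairs) + length (map (negate ∘ column) pairs)
        ≡⟨ length-++ (map column pairs) ⟨
      length columns
        ∎
      where
      open ≡-Reasoning
      length-pairs : length pairs ≡ (t ∸ 1) + (t ∸ 1)
      length-pairs = trans (sym (trans (length-map abs (map proj₁ pairs)) (length-map proj₁ pairs)))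
                           (trans (↭-length xs-cover) length-halfResidues)

    D : Fin 3 → Fin (4 * (t ∸ 1)) → Fin (4 * t)
    D i k = lookup columns (cast length-columns k) i mod (4 * t)

    columns-rowDiff : ∀ {i j} → i ≢ j →
      map (λ c → c i ⊖ c j) columns ≡ map (rowDiff i j) pairs ++ map (4 * t ∸_) (map (rowDiff i j) pairs)
    columns-rowDiff {i} {j} i≢j = begin
      map (λ c → c i ⊖ c j) columns
        ≡⟨ map-++ (λ c → c i ⊖ c j) (map column pairs) _ ⟩
      map (λ c → c i ⊖ c j) (map column pairs) ++ map (λ c → c i ⊖ c j) (map (negate ∘ column) pairs)
        ≡⟨ cong₂ _++_ (sym (map-∘ pairs)) (sym (map-∘ pairs)) ⟩
      map (rowDiff i j) pairs ++ map (λ p → negate (column p) i ⊖ negate (column p) j) pairs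
        ≡⟨ cong (map (rowDiff i j) pairs ++_)
                (trans (map-cong-local (All.map (λ pc → negate-⊖ pc i≢j) proper)) (map-∘ pairs)) ⟩
      map (rowDiff i j) pairs ++ map (4 * t ∸_) (map (rowDiff i j) pairs)
        ∎
      where open ≡-Reasoning

    columns≤4t : ∀ j → All (λ c → c j ≤ 4 * t) columns
    columns≤4t j = All-++⁺ (map⁺ (All.map (λ (c<4t , _) → <⇒≤ (c<4t j)) proper))
                       (map⁺ (All.tabulate (λ {p} _ → m∸n≤m (4 * t) (column p j))))

    isCHDM : IsCHDM 3 4 t D
    isCHDM i j i≢j e t∤e = begin
      count (4 * (t ∸ 1)) (λ k → subMod (4 * t) (D i k) (D j k)) (toℕ e)
        ≡⟨ length-filter≡occ-map (λ k → subMod (4 * t) (D i k) (D j k)) (toℕ e) (allFin _) ⟩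
      occ (toℕ e) (map (λ k → subMod (4 * t) (D i k) (D j k)) (allFin _))
        ≡⟨ cong (occ (toℕ e)) (map-cong (λ k → subMod-mod (4 * t) (column-at k i) (column-at k j)) (allFin _)) ⟩
      occ (toℕ e) (map (λ k → reducedDiff (column-at k)) (allFin _))
        ≡⟨ cong (occ (toℕ e)) (map-lookup-allFin reducedDiff columns length-columns) ⟩
      occ (toℕ e) (map reducedDiff columns)
        ≡⟨ cong (occ (toℕ e)) (map-cong-local (All.map ⊖-mod (columns≤4t j))) ⟩
      occ (toℕ e) (map (λ c → c i ⊖ c j) columns)
        ≡⟨ cong (occ (toℕ e)) (columns-rowDiff i≢j) ⟩
      occ (toℕ e) (map (rowDiff i j) pairs ++ map (4 * t ∸_) (map (rowDiff i j) pairs))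
        ≡⟨ covers-count (covers-rowDiff i j i≢j) (toℕ<n e) t∤e ⟩
      1 ∎
      where
      open ≡-Reasoning
      column-at : Fin (4 * (t ∸ 1)) → Fin 3 → ℕ
      column-at k = lookup columns (cast length-columns k)
      reducedDiff : (Fin 3 → ℕ) → ℕ
      reducedDiff c = (c i % (4 * t) + (4 * t ∸ c j % (4 * t))) % (4 * t)

  starter⇒CHDM : Starter → CHDM t
  starter⇒CHDM S = D S , isCHDM S

  -- Blocks

  opaque
    unfolding block

    map-δ-block : ∀ {x y d} L → x + L + d ≡ suc y → y + L ≤ 4 * t → map δ (block x y L) ≡ apᵈ d 2 L
    map-δ-block zero _ _ = refl
    map-δ-block {x} {y} {d} (suc n) eq y+L≤4t =
      cong₂ _∷_ head (map-δ-block n eq′ (≤-trans (+-monoʳ-≤ y (n≤1+n n)) y+L≤4t))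
      where
      x+n+d≡y : x + n + d ≡ y
      x+n+d≡y = suc-injective (trans (cong (_+ d) (sym (+-suc x n))) eq)
      eq′ : x + 1 + n + d ≡ suc y
      eq′ = trans (arith x n d) (cong suc x+n+d≡y)
        where
        arith : ∀ x n d → x + 1 + n + d ≡ suc (x + n + d)
        arith = solve-∀
      head : y + n * 1 ⊖ x ≡ d + n * 2
      head = ⊖-≡ {a = x} (trans (arith x n d) (cong (_+ n * 1) x+n+d≡y))
                 (<-≤-trans (+-monoʳ-< y (subst (_< suc n) (sym (*-identityʳ n)) (n<1+n n))) y+L≤4t)
        where
        arith : ∀ x n d → x + (d + n * 2) ≡ x + n + d + n * 1
        arith = solve-∀

    map-δ-block-wrap : ∀ {x y w} L → y + L + w ≡ suc x → x + L ≤ 4 * t → 0 < w →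
                       map δ (block x y L) ≡ map (4 * t ∸_) (ap w 2 L)
    map-δ-block-wrap zero _ _ _ = refl
    map-δ-block-wrap {x} {y} {w} (suc n) eq x+L≤4t 0<w =
      cong₂ _∷_ head (map-δ-block-wrap n eq′ (subst (_≤ 4 * t) (sym (+-assoc x 1 n)) x+L≤4t) (<-≤-trans 0<w (m≤m+n w 2)))
      where
      y+n+w≡x : y + n * 1 + w ≡ x
      y+n+w≡x = suc-injective (trans (arith y n w) eq)
        where
        arith : ∀ y n w → suc (y + n * 1 + w) ≡ y + suc n + w
        arith = solve-∀
      eq′ : y + n + (w + 2) ≡ suc (x + 1)
      eq′ = trans (arith y n w) (cong (λ m → suc (m + 1)) y+n+w≡x)
        where
        arith : ∀ y n w → y + n + (w + 2) ≡ suc (y + n * 1 + w + 1)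
        arith = solve-∀
      head : y + n * 1 ⊖ x ≡ 4 * t ∸ w
      head = ⊖-wrap {b = y + n * 1} {w = w} y+n+w≡x (≤-trans (m≤m+n x (suc n)) x+L≤4t) 0<w

  block-xs : ∀ {x y L} → x + L * 1 ≤ t + t + 1 → map abs (map proj₁ (block x y L)) ↭ ap x 1 L
  block-xs {x} {y} {L} end≤ = ↭-reflexive (begin
    map abs (map proj₁ (block x y L)) ≡⟨ cong (map abs) (map-proj₁-block x y L) ⟩
    map abs (ap x 1 L)                ≡⟨ map-abs-≤ (ap-bounded end≤) ⟩
    ap x 1 L                          ∎)
    where open ≡-Reasoning

  block-ys-low : ∀ {x y L} → y + L * 1 ≤ t + t + 1 → map abs (map proj₂ (block x y L)) ↭ ap y 1 L
  block-ys-low {x} {y} {L} end≤ = begin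
    map abs (map proj₂ (block x y L)) ≡⟨ cong (map abs) (map-proj₂-block x y L) ⟩
    map abs (apᵈ y 1 L)               ≡⟨ map-abs-≤ (apᵈ-All (ap-bounded end≤)) ⟩
    apᵈ y 1 L                         ↭⟨ apᵈ↭ap y 1 L ⟩
    ap y 1 L                          ∎
    where open PermutationReasoning

  block-ys-high : ∀ {x y L} z → t + t < y → y + L * 1 + z ≡ 4 * t + 1 →
                  map abs (map proj₂ (block x y L)) ↭ ap z 1 L
  block-ys-high {x} {y} {L} z 2t<y eq = ↭-reflexive (begin
    map abs (map proj₂ (block x y L)) ≡⟨ cong (map abs) (map-proj₂-block x y L) ⟩
    map abs (apᵈ y 1 L)               ≡⟨ map-abs-> (apᵈ-All (ap-above 2t<y)) ⟩
    map (4 * t ∸_) (apᵈ y 1 L)        ≡⟨ map-∸-apᵈ (4 * t) L eq ⟩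
    ap z 1 L                          ∎)
    where open ≡-Reasoning

  block-δ-low : ∀ {x y L} d → x + L + d ≡ suc y → y + L ≤ 4 * t → d + L * 2 ≤ t + t + 2 →
                map abs (map δ (block x y L)) ↭ ap d 2 L
  block-δ-low {x} {y} {L} d eq y+L≤4t end≤ = begin
    map abs (map δ (block x y L)) ≡⟨ cong (map abs) (map-δ-block L eq y+L≤4t) ⟩
    map abs (apᵈ d 2 L)           ≡⟨ map-abs-≤ (apᵈ-All (ap-bounded end≤)) ⟩
    apᵈ d 2 L                     ↭⟨ apᵈ↭ap d 2 L ⟩
    ap d 2 L                      ∎
    where open PermutationReasoning

  block-δ-high : ∀ {x y L} d z → x + L + d ≡ suc y → y + L ≤ 4 * t → t + t < d →
                 d + L * 2 + z ≡ 4 * t + 2 →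
                 map abs (map δ (block x y L)) ↭ ap z 2 L
  block-δ-high {x} {y} {L} d z eq y+L≤4t 2t<d eq′ = ↭-reflexive (begin
    map abs (map δ (block x y L)) ≡⟨ cong (map abs) (map-δ-block L eq y+L≤4t) ⟩
    map abs (apᵈ d 2 L)           ≡⟨ map-abs-> (apᵈ-All (ap-above 2t<d)) ⟩
    map (4 * t ∸_) (apᵈ d 2 L)    ≡⟨ map-∸-apᵈ (4 * t) L eq′ ⟩
    ap z 2 L                      ∎)
    where open ≡-Reasoning

  block-δ-wrap : ∀ {x y L} w → y + L + w ≡ suc x → x + L ≤ 4 * t → 0 < w → w + L * 2 ≤ t + t + 2 →
                 map abs (map δ (block x y L)) ↭ ap w 2 L
  block-δ-wrap {x} {y} {L} w eq x+L≤4t 0<w end≤ = ↭-reflexive (begin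
    map abs (map δ (block x y L))         ≡⟨ cong (map abs) (map-δ-block-wrap L eq x+L≤4t 0<w) ⟩
    map abs (map (4 * t ∸_) (ap w 2 L))   ≡⟨ map-abs-∸ (All.map (λ c≤2t → ≤-trans c≤2t 2t≤4t) below) ⟩
    map abs (ap w 2 L)                    ≡⟨ map-abs-≤ below ⟩
    ap w 2 L                              ∎)
    where
    open ≡-Reasoning
    below : All (_≤ t + t) (ap w 2 L)
    below = ap-bounded end≤
    2t≤4t : t + t ≤ 4 * t
    2t≤4t = subst (t + t ≤_) (sym (4*m≡[m+m]+[m+m] t)) (m≤m+n (t + t) (t + t))

  record Block : Set where
    field
      x y L : ℕ
      {xs ys δs} : List ℕ
      xs-classes : map abs (map proj₁ (block x y L)) ↭ xs
      ys-classes : map abs (map proj₂ (block x y L)) ↭ ys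
      δs-classes : map abs (map δ (block x y L)) ↭ δs

    pairs : List (ℕ × ℕ)
    pairs = block x y L

  open Block public using (pairs; xs; ys; δs)

  blocks-classes : ∀ (g : ℕ × ℕ → ℕ) (classes : Block → List ℕ) →
                   (∀ B → map abs (map g (pairs B)) ↭ classes B) →
                   ∀ Bs → map abs (map g (concat (map pairs Bs))) ↭ concat (map classes Bs)
  blocks-classes g classes B-classes [] = ↭-refl
  blocks-classes g classes B-classes (B ∷ Bs) = begin
    map abs (map g (pairs B ++ concat (map pairs Bs)))
      ≡⟨ cong (map abs) (map-++ g (pairs B) (concat (map pairs Bs))) ⟩
    map abs (map g (pairs B) ++ map g (concat (map pairs Bs)))
      ≡⟨ map-++ abs (map g (pairs B)) (map g (concat (map pairs Bs))) ⟩
    map abs (map g (pairs B)) ++ map abs (map g (concat (map pairs Bs)))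
      ↭⟨ ++⁺ (B-classes B) (blocks-classes g classes B-classes Bs) ⟩
    classes B ++ concat (map classes Bs)
      ∎
    where open PermutationReasoning

  blocks-starter : ∀ Bs → concat (map xs Bs) ↭ halfResidues → concat (map ys Bs) ↭ halfResidues →
                   concat (map δs Bs) ↭ halfResidues → Starter
  blocks-starter Bs xs-tiling ys-tiling δs-tiling = record
    { pairs    = concat (map pairs Bs)
    ; xs-cover = ↭-trans (blocks-classes proj₁ xs Block.xs-classes Bs) xs-tiling
    ; ys-cover = ↭-trans (blocks-classes proj₂ ys Block.ys-classes Bs) ys-tiling
    ; δ-cover  = ↭-trans (blocks-classes δ δs Block.δs-classes Bs) δs-tiling
    }

-- Explicit starters

m+k≡n⇒m≤n : ∀ {m n} k → m + k ≡ n → m ≤ n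
m+k≡n⇒m≤n {m} k refl = m≤m+n m k

module EvenStarter (a : ℕ) where
  open Starters (4 + 2 * a)
  open CommutativeMonoidSolver (++-commutativeMonoid {A = ℕ}) using (_⊕_; _⊜_; id) renaming (solve to reorder)

  B₁ B₂ B₃ B₄ B₅ B₆ : Block
  B₁ = record
    { x = 1 ; y = 15 + 8 * a ; L = 1
    ; xs-classes = block-xs (m+k≡n⇒m≤n (7 + 4 * a) (solve (a ∷ [])))
    ; ys-classes = block-ys-high 1 (m+k≡n⇒m≤n (6 + 4 * a) (solve (a ∷ []))) (solve (a ∷ []))
    ; δs-classes = block-δ-high (14 + 8 * a) 2 (solve (a ∷ [])) (m+k≡n⇒m≤n 0 (solve (a ∷ [])))
                     (m+k≡n⇒m≤n (5 + 4 * a) (solve (a ∷ []))) (solve (a ∷ []))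
    }
  B₂ = record
    { x = 5 + 2 * a ; y = 8 + 3 * a ; L = a
    ; xs-classes = block-xs (m+k≡n⇒m≤n (4 + a) (solve (a ∷ [])))
    ; ys-classes = block-ys-low (m+k≡n⇒m≤n 1 (solve (a ∷ [])))
    ; δs-classes = block-δ-low 4 (solve (a ∷ [])) (m+k≡n⇒m≤n (8 + 4 * a) (solve (a ∷ [])))
                     (m+k≡n⇒m≤n (6 + 2 * a) (solve (a ∷ [])))
    }
  B₃ = record
    { x = 5 + 3 * a ; y = 9 + 5 * a ; L = 2
    ; xs-classes = block-xs (m+k≡n⇒m≤n (2 + a) (solve (a ∷ [])))
    ; ys-classes = block-ys-high (6 + 3 * a) (m+k≡n⇒m≤n a (solve (a ∷ []))) (solve (a ∷ []))
    ; δs-classes = ↭-trans (block-δ-low (3 + 2 * a) (solve (a ∷ [])) (m+k≡n⇒m≤n (5 + 3 * a) (solve (a ∷ [])))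
                              (m+k≡n⇒m≤n (3 + 2 * a) (solve (a ∷ []))))
                     (↭-reflexive (sym (ap-join {m = 1} {b = 5 + 2 * a} (solve (a ∷ [])) refl)))
    }
  B₄ = record
    { x = 2 ; y = 11 + 5 * a ; L = 1 + a
    ; xs-classes = block-xs (m+k≡n⇒m≤n (6 + 3 * a) (solve (a ∷ [])))
    ; ys-classes = block-ys-high (5 + 2 * a) (m+k≡n⇒m≤n (2 + a) (solve (a ∷ []))) (solve (a ∷ []))
    ; δs-classes = block-δ-high (9 + 4 * a) (7 + 2 * a) (solve (a ∷ [])) (m+k≡n⇒m≤n (4 + 2 * a) (solve (a ∷ [])))
                     (m+k≡n⇒m≤n 0 (solve (a ∷ []))) (solve (a ∷ []))
    }
  B₅ = record
    { x = 3 + a ; y = 2 ; L = 1 + a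
    ; xs-classes = block-xs (m+k≡n⇒m≤n (5 + 2 * a) (solve (a ∷ [])))
    ; ys-classes = block-ys-low (m+k≡n⇒m≤n (6 + 3 * a) (solve (a ∷ [])))
    ; δs-classes = block-δ-wrap 1 (solve (a ∷ [])) (m+k≡n⇒m≤n (12 + 6 * a) (solve (a ∷ []))) z<s
                     (m+k≡n⇒m≤n (7 + 2 * a) (solve (a ∷ [])))
    }
  B₆ = record
    { x = 7 + 3 * a ; y = 13 + 6 * a ; L = 1 + a
    ; xs-classes = block-xs (m+k≡n⇒m≤n 1 (solve (a ∷ [])))
    ; ys-classes = block-ys-high (3 + a) (m+k≡n⇒m≤n (4 + 2 * a) (solve (a ∷ []))) (solve (a ∷ []))
    ; δs-classes = block-δ-low (6 + 2 * a) (solve (a ∷ [])) (m+k≡n⇒m≤n (2 + a) (solve (a ∷ [])))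
                     (m+k≡n⇒m≤n 2 (solve (a ∷ [])))
    }

  blocks : List Block
  blocks = B₁ ∷ B₂ ∷ B₃ ∷ B₄ ∷ B₅ ∷ B₆ ∷ []

  lower-half : ap 1 1 1 ++ ap 2 1 (1 + a) ++ ap (3 + a) 1 (1 + a) ≡ ap 1 1 (3 + 2 * a)
  lower-half = trans (cong (ap 1 1 1 ++_) (ap-join {k = 2 + 2 * a} (solve (a ∷ [])) (solve (a ∷ []))))
                     (ap-join refl refl)

  xs-tiling : concat (map xs blocks) ↭ halfResidues
  xs-tiling = begin
    concat (map xs blocks)
      ↭⟨ reorder 6 (λ b₁ b₂ b₃ b₄ b₅ b₆ → b₁ ⊕ b₂ ⊕ b₃ ⊕ b₄ ⊕ b₅ ⊕ b₆ ⊕ id ⊜ (b₁ ⊕ b₄ ⊕ b₅) ⊕ (b₂ ⊕ b₃ ⊕ b₆))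
                 ↭-refl (xs B₁) (xs B₂) (xs B₃) (xs B₄) (xs B₅) (xs B₆) ⟩
    (ap 1 1 1 ++ ap 2 1 (1 + a) ++ ap (3 + a) 1 (1 + a)) ++
    (ap (5 + 2 * a) 1 a ++ ap (5 + 3 * a) 1 2 ++ ap (7 + 3 * a) 1 (1 + a))
      ≡⟨ cong₂ _++_ lower-half upper-half ⟩
    ap 1 1 (3 + 2 * a) ++ ap (5 + 2 * a) 1 (3 + 2 * a)
      ≡⟨⟩
    halfResidues
      ∎
    where
    open PermutationReasoning
    upper-half : ap (5 + 2 * a) 1 a ++ ap (5 + 3 * a) 1 2 ++ ap (7 + 3 * a) 1 (1 + a) ≡ ap (5 + 2 * a) 1 (3 + 2 * a)
    upper-half = trans (cong (ap (5 + 2 * a) 1 a ++_) (ap-join {k = 3 + a} (solve (a ∷ [])) refl))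
                       (ap-join (solve (a ∷ [])) (solve (a ∷ [])))

  ys-tiling : concat (map ys blocks) ↭ halfResidues
  ys-tiling = begin
    concat (map ys blocks)
      ↭⟨ reorder 6 (λ b₁ b₂ b₃ b₄ b₅ b₆ → b₁ ⊕ b₂ ⊕ b₃ ⊕ b₄ ⊕ b₅ ⊕ b₆ ⊕ id ⊜ (b₁ ⊕ b₅ ⊕ b₆) ⊕ (b₄ ⊕ b₃ ⊕ b₂))
                 ↭-refl (ys B₁) (ys B₂) (ys B₃) (ys B₄) (ys B₅) (ys B₆) ⟩
    (ap 1 1 1 ++ ap 2 1 (1 + a) ++ ap (3 + a) 1 (1 + a)) ++
    (ap (5 + 2 * a) 1 (1 + a) ++ ap (6 + 3 * a) 1 2 ++ ap (8 + 3 * a) 1 a)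
      ≡⟨ cong₂ _++_ lower-half upper-half ⟩
    ap 1 1 (3 + 2 * a) ++ ap (5 + 2 * a) 1 (3 + 2 * a)
      ≡⟨⟩
    halfResidues
      ∎
    where
    open PermutationReasoning
    upper-half : ap (5 + 2 * a) 1 (1 + a) ++ ap (6 + 3 * a) 1 2 ++ ap (8 + 3 * a) 1 a ≡ ap (5 + 2 * a) 1 (3 + 2 * a)
    upper-half = trans (cong (ap (5 + 2 * a) 1 (1 + a) ++_) (ap-join {k = 2 + a} (solve (a ∷ [])) refl))
                       (ap-join (solve (a ∷ [])) (solve (a ∷ [])))

  δs-tiling : concat (map δs blocks) ↭ halfResidues
  δs-tiling = begin
    concat (map δs blocks)
      ↭⟨ reorder 7 (λ b₁ b₂ b₃ b₃′ b₄ b₅ b₆ → b₁ ⊕ b₂ ⊕ (b₃ ⊕ b₃′) ⊕ b₄ ⊕ b₅ ⊕ b₆ ⊕ id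
                                          ⊜ ((b₅ ⊕ b₃) ⊕ (b₁ ⊕ b₂)) ⊕ ((b₃′ ⊕ b₄) ⊕ b₆))
                 ↭-refl (δs B₁) (δs B₂) (ap (3 + 2 * a) 2 1) (ap (5 + 2 * a) 2 1) (δs B₄) (δs B₅) (δs B₆) ⟩
    ((ap 1 2 (1 + a) ++ ap (3 + 2 * a) 2 1) ++ (ap 2 2 1 ++ ap 4 2 a)) ++
    ((ap (5 + 2 * a) 2 1 ++ ap (7 + 2 * a) 2 (1 + a)) ++ ap (6 + 2 * a) 2 (1 + a))
      ≡⟨ cong₂ _++_ (cong₂ _++_ (ap-join (solve (a ∷ [])) (solve (a ∷ []))) (ap-join refl refl))
                    (cong (_++ ap (6 + 2 * a) 2 (1 + a)) (ap-join (solve (a ∷ [])) (solve (a ∷ [])))) ⟩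
    (ap 1 2 (2 + a) ++ ap 2 2 (1 + a)) ++ (ap (5 + 2 * a) 2 (2 + a) ++ ap (6 + 2 * a) 2 (1 + a))
      ↭⟨ ++⁺ (ap-interleave (s≤s z≤n) (solve (a ∷ [])) refl refl)
             (ap-interleave (s≤s z≤n) (solve (a ∷ [])) refl (solve (a ∷ []))) ⟨
    ap 1 1 (3 + 2 * a) ++ ap (5 + 2 * a) 1 (3 + 2 * a)
      ≡⟨⟩
    halfResidues
      ∎
    where open PermutationReasoning

  starter : Starter
  starter = blocks-starter blocks xs-tiling ys-tiling δs-tiling

module OddStarter (a : ℕ) where
  open Starters (5 + 2 * a)
  open CommutativeMonoidSolver (++-commutativeMonoid {A = ℕ}) using (_⊕_; _⊜_; id) renaming (solve to reorder)

  B₁ B₂ B₃ B₄ B₅ B₆ B₇ B₈ : Block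
  B₁ = record
    { x = 1 ; y = 9 + 4 * a ; L = 1
    ; xs-classes = block-xs (m+k≡n⇒m≤n (9 + 4 * a) (solve (a ∷ [])))
    ; ys-classes = block-ys-low (m+k≡n⇒m≤n 1 (solve (a ∷ [])))
    ; δs-classes = block-δ-low (8 + 4 * a) (solve (a ∷ [])) (m+k≡n⇒m≤n (10 + 4 * a) (solve (a ∷ [])))
                     (m+k≡n⇒m≤n 2 (solve (a ∷ [])))
    }
  B₂ = record
    { x = 2 ; y = 15 + 5 * a ; L = a
    ; xs-classes = block-xs (m+k≡n⇒m≤n (9 + 3 * a) (solve (a ∷ [])))
    ; ys-classes = block-ys-high (6 + 2 * a) (m+k≡n⇒m≤n (4 + a) (solve (a ∷ []))) (solve (a ∷ []))
    ; δs-classes = block-δ-high (14 + 4 * a) (8 + 2 * a) (solve (a ∷ [])) (m+k≡n⇒m≤n (5 + 2 * a) (solve (a ∷ [])))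
                     (m+k≡n⇒m≤n 3 (solve (a ∷ []))) (solve (a ∷ []))
    }
  B₃ = record
    { x = 8 + 3 * a ; y = 18 + 6 * a ; L = a
    ; xs-classes = block-xs (m+k≡n⇒m≤n 3 (solve (a ∷ [])))
    ; ys-classes = block-ys-high (3 + a) (m+k≡n⇒m≤n (7 + 2 * a) (solve (a ∷ []))) (solve (a ∷ []))
    ; δs-classes = block-δ-low (11 + 2 * a) (solve (a ∷ [])) (m+k≡n⇒m≤n (2 + a) (solve (a ∷ [])))
                     (m+k≡n⇒m≤n 1 (solve (a ∷ [])))
    }
  B₄ = record
    { x = 8 + 4 * a ; y = 16 + 6 * a ; L = 2
    ; xs-classes = block-xs (m+k≡n⇒m≤n 1 (solve (a ∷ [])))
    ; ys-classes = block-ys-high (3 + 2 * a) (m+k≡n⇒m≤n (5 + 2 * a) (solve (a ∷ []))) (solve (a ∷ []))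
    ; δs-classes = block-δ-low (7 + 2 * a) (solve (a ∷ [])) (m+k≡n⇒m≤n (2 + 2 * a) (solve (a ∷ [])))
                     (m+k≡n⇒m≤n (1 + 2 * a) (solve (a ∷ [])))
    }
  B₅ = record
    { x = 6 + 2 * a ; y = 8 + 3 * a ; L = 1 + a
    ; xs-classes = block-xs (m+k≡n⇒m≤n (4 + a) (solve (a ∷ [])))
    ; ys-classes = block-ys-low (m+k≡n⇒m≤n 2 (solve (a ∷ [])))
    ; δs-classes = block-δ-low 2 (solve (a ∷ [])) (m+k≡n⇒m≤n (11 + 4 * a) (solve (a ∷ [])))
                     (m+k≡n⇒m≤n (8 + 2 * a) (solve (a ∷ [])))
    }
  B₆ = record
    { x = 7 + 3 * a ; y = 13 + 5 * a ; L = 1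
    ; xs-classes = block-xs (m+k≡n⇒m≤n (3 + a) (solve (a ∷ [])))
    ; ys-classes = block-ys-high (7 + 3 * a) (m+k≡n⇒m≤n (2 + a) (solve (a ∷ []))) (solve (a ∷ []))
    ; δs-classes = block-δ-low (6 + 2 * a) (solve (a ∷ [])) (m+k≡n⇒m≤n (6 + 3 * a) (solve (a ∷ [])))
                     (m+k≡n⇒m≤n (4 + 2 * a) (solve (a ∷ [])))
    }
  B₇ = record
    { x = 2 + a ; y = 6 + 3 * a ; L = 1
    ; xs-classes = block-xs (m+k≡n⇒m≤n (8 + 3 * a) (solve (a ∷ [])))
    ; ys-classes = block-ys-low (m+k≡n⇒m≤n (4 + a) (solve (a ∷ [])))
    ; δs-classes = block-δ-low (4 + 2 * a) (solve (a ∷ [])) (m+k≡n⇒m≤n (13 + 5 * a) (solve (a ∷ [])))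
                     (m+k≡n⇒m≤n (6 + 2 * a) (solve (a ∷ [])))
    }
  B₈ = record
    { x = 3 + a ; y = 1 ; L = 2 + a
    ; xs-classes = block-xs (m+k≡n⇒m≤n (6 + 2 * a) (solve (a ∷ [])))
    ; ys-classes = block-ys-low (m+k≡n⇒m≤n (8 + 3 * a) (solve (a ∷ [])))
    ; δs-classes = block-δ-wrap 1 (solve (a ∷ [])) (m+k≡n⇒m≤n (15 + 6 * a) (solve (a ∷ []))) z<s
                     (m+k≡n⇒m≤n (7 + 2 * a) (solve (a ∷ [])))
    }

  blocks : List Block
  blocks = B₁ ∷ B₂ ∷ B₃ ∷ B₄ ∷ B₅ ∷ B₆ ∷ B₇ ∷ B₈ ∷ []

  xs-tiling : concat (map xs blocks) ↭ halfResidues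
  xs-tiling = begin
    concat (map xs blocks)
      ↭⟨ reorder 8 (λ b₁ b₂ b₃ b₄ b₅ b₆ b₇ b₈ → b₁ ⊕ b₂ ⊕ b₃ ⊕ b₄ ⊕ b₅ ⊕ b₆ ⊕ b₇ ⊕ b₈ ⊕ id
                                             ⊜ (b₁ ⊕ b₂ ⊕ b₇ ⊕ b₈) ⊕ (b₅ ⊕ b₆ ⊕ b₃ ⊕ b₄))
                 ↭-refl (xs B₁) (xs B₂) (xs B₃) (xs B₄) (xs B₅) (xs B₆) (xs B₇) (xs B₈) ⟩
    (ap 1 1 1 ++ ap 2 1 a ++ ap (2 + a) 1 1 ++ ap (3 + a) 1 (2 + a)) ++
    (ap (6 + 2 * a) 1 (1 + a) ++ ap (7 + 3 * a) 1 1 ++ ap (8 + 3 * a) 1 a ++ ap (8 + 4 * a) 1 2)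
      ≡⟨ cong₂ _++_ lower-half upper-half ⟩
    ap 1 1 (4 + 2 * a) ++ ap (6 + 2 * a) 1 (4 + 2 * a)
      ≡⟨⟩
    halfResidues
      ∎
    where
    open PermutationReasoning
    lower-half : ap 1 1 1 ++ ap 2 1 a ++ ap (2 + a) 1 1 ++ ap (3 + a) 1 (2 + a) ≡ ap 1 1 (4 + 2 * a)
    lower-half =
      trans (cong (λ l → ap 1 1 1 ++ ap 2 1 a ++ l) (ap-join {k = 3 + a} (solve (a ∷ [])) (solve (a ∷ []))))
     (trans (cong (ap 1 1 1 ++_) (ap-join {k = 3 + 2 * a} (solve (a ∷ [])) (solve (a ∷ []))))
            (ap-join refl refl))
    upper-half : ap (6 + 2 * a) 1 (1 + a) ++ ap (7 + 3 * a) 1 1 ++ ap (8 + 3 * a) 1 a ++ ap (8 + 4 * a) 1 2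
                 ≡ ap (6 + 2 * a) 1 (4 + 2 * a)
    upper-half =
      trans (cong (λ l → ap (6 + 2 * a) 1 (1 + a) ++ ap (7 + 3 * a) 1 1 ++ l)
                  (ap-join {k = 2 + a} (solve (a ∷ [])) (solve (a ∷ []))))
     (trans (cong (ap (6 + 2 * a) 1 (1 + a) ++_) (ap-join {k = 3 + a} (solve (a ∷ [])) (solve (a ∷ []))))
            (ap-join (solve (a ∷ [])) (solve (a ∷ []))))

  ys-tiling : concat (map ys blocks) ↭ halfResidues
  ys-tiling = begin
    concat (map ys blocks)
      ↭⟨ reorder 8 (λ b₁ b₂ b₃ b₄ b₅ b₆ b₇ b₈ → b₁ ⊕ b₂ ⊕ b₃ ⊕ b₄ ⊕ b₅ ⊕ b₆ ⊕ b₇ ⊕ b₈ ⊕ id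
                                             ⊜ (b₈ ⊕ b₃ ⊕ b₄) ⊕ (b₂ ⊕ b₇ ⊕ b₆ ⊕ b₅ ⊕ b₁))
                 ↭-refl (ys B₁) (ys B₂) (ys B₃) (ys B₄) (ys B₅) (ys B₆) (ys B₇) (ys B₈) ⟩
    (ap 1 1 (2 + a) ++ ap (3 + a) 1 a ++ ap (3 + 2 * a) 1 2) ++
    (ap (6 + 2 * a) 1 a ++ ap (6 + 3 * a) 1 1 ++ ap (7 + 3 * a) 1 1 ++ ap (8 + 3 * a) 1 (1 + a) ++ ap (9 + 4 * a) 1 1)
      ≡⟨ cong₂ _++_ lower-half upper-half ⟩
    ap 1 1 (4 + 2 * a) ++ ap (6 + 2 * a) 1 (4 + 2 * a)
      ≡⟨⟩
    halfResidues
      ∎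
    where
    open PermutationReasoning
    lower-half : ap 1 1 (2 + a) ++ ap (3 + a) 1 a ++ ap (3 + 2 * a) 1 2 ≡ ap 1 1 (4 + 2 * a)
    lower-half = trans (cong (ap 1 1 (2 + a) ++_) (ap-join {k = 2 + a} (solve (a ∷ [])) (solve (a ∷ []))))
                       (ap-join (solve (a ∷ [])) (solve (a ∷ [])))
    upper-half : ap (6 + 2 * a) 1 a ++ ap (6 + 3 * a) 1 1 ++ ap (7 + 3 * a) 1 1 ++ ap (8 + 3 * a) 1 (1 + a)
                   ++ ap (9 + 4 * a) 1 1
                 ≡ ap (6 + 2 * a) 1 (4 + 2 * a)
    upper-half =
      trans (cong (λ l → ap (6 + 2 * a) 1 a ++ ap (6 + 3 * a) 1 1 ++ ap (7 + 3 * a) 1 1 ++ l)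
                  (ap-join {k = 2 + a} (solve (a ∷ [])) (solve (a ∷ []))))
     (trans (cong (λ l → ap (6 + 2 * a) 1 a ++ ap (6 + 3 * a) 1 1 ++ l)
                  (ap-join {k = 3 + a} (solve (a ∷ [])) (solve (a ∷ []))))
     (trans (cong (ap (6 + 2 * a) 1 a ++_) (ap-join {k = 4 + a} (solve (a ∷ [])) (solve (a ∷ []))))
            (ap-join (solve (a ∷ [])) (solve (a ∷ [])))))

  δs-tiling : concat (map δs blocks) ↭ halfResidues
  δs-tiling = begin
    concat (map δs blocks)
      ↭⟨ reorder 8 (λ b₁ b₂ b₃ b₄ b₅ b₆ b₇ b₈ → b₁ ⊕ b₂ ⊕ b₃ ⊕ b₄ ⊕ b₅ ⊕ b₆ ⊕ b₇ ⊕ b₈ ⊕ id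
                                             ⊜ (b₈ ⊕ (b₅ ⊕ b₇)) ⊕ ((b₆ ⊕ (b₂ ⊕ b₁)) ⊕ (b₄ ⊕ b₃)))
                 ↭-refl (δs B₁) (δs B₂) (δs B₃) (δs B₄) (δs B₅) (δs B₆) (δs B₇) (δs B₈) ⟩
    (ap 1 2 (2 + a) ++ (ap 2 2 (1 + a) ++ ap (4 + 2 * a) 2 1)) ++
    ((ap (6 + 2 * a) 2 1 ++ (ap (8 + 2 * a) 2 a ++ ap (8 + 4 * a) 2 1)) ++ (ap (7 + 2 * a) 2 2 ++ ap (11 + 2 * a) 2 a))
      ≡⟨ cong₂ _++_ (cong (ap 1 2 (2 + a) ++_) (ap-join (solve (a ∷ [])) (solve (a ∷ []))))
                    (cong₂ _++_ (trans (cong (ap (6 + 2 * a) 2 1 ++_) (ap-join {k = 1 + a} (solve (a ∷ [])) (solve (a ∷ []))))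
                                       (ap-join (solve (a ∷ [])) (solve (a ∷ []))))
                                (ap-join (solve (a ∷ [])) refl)) ⟩
    (ap 1 2 (2 + a) ++ ap 2 2 (2 + a)) ++ (ap (6 + 2 * a) 2 (2 + a) ++ ap (7 + 2 * a) 2 (2 + a))
      ↭⟨ ++⁺ (ap-interleave z≤n (solve (a ∷ [])) refl refl)
             (ap-interleave z≤n (solve (a ∷ [])) refl (solve (a ∷ []))) ⟨
    ap 1 1 (4 + 2 * a) ++ ap (6 + 2 * a) 1 (4 + 2 * a)
      ≡⟨⟩
    halfResidues
      ∎
    where open PermutationReasoning

  starter : Starter
  starter = blocks-starter blocks xs-tiling ys-tiling δs-tiling

halve : ∀ k → ∃[ a ] (k ≡ 2 * a ⊎ k ≡ 1 + 2 * a)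
halve zero = 0 , inj₁ refl
halve (suc k) with halve k
... | a , inj₁ k≡2a = a , inj₂ (cong suc k≡2a)
... | a , inj₂ k≡1+2a = suc a , inj₁ (trans (cong suc k≡1+2a) (sym (*-suc 2 a)))

chdm-4+ : ∀ k → CHDM (4 + k)
chdm-4+ k with halve k
... | a , inj₁ refl = Starters.starter⇒CHDM (4 + 2 * a) (EvenStarter.starter a)
... | a , inj₂ refl = Starters.starter⇒CHDM (5 + 2 * a) (OddStarter.starter a)

lemma5p4 : (t : ℕ) → 4 ≤ t →
    Σ (Fin 3 → Fin (4 * (t ∸ 1)) → Fin (4 * t)) (λ D → IsCHDM 3 4 t D)
lemma5p4 t 4≤t = subst CHDM (m+[n∸m]≡n 4≤t) (chdm-4+ (t ∸ 4))
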